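{- Let $R$ be a ring. If $N_1,N_2\in K^{\mathfrak{s}\text{ -Tor}}$ and $N_1,N_2\leq_p N$ for some left $R$-module $N$, then there is $L\in K^{\mathfrak{s}\text{ -Tor}}$ with $N_1,N_2\leq_p L\subseteq N$ (i.e. $(K^{\mathfrak{s}\text{ -Tor}},\leq_p)$ is nicely generated in $(R\text{ -Mod},\leq_p)$).
   Context: Modules are left $R$-modules. A pp-formula is an existentially quantified finite system of $R$-linear equations; $N\leq_p M$ means pp-formulas with parameters in $N$ true in $M$ are true in $N$. A pp-formula $\psi(x)$ is low if $\psi[{}_RR]=0$. $\mathfrak{s}(M)=\{m\in M:M\models\psi[m]$ for some low $\psi\}$; $M$ is $\mathfrak{s}$-torsion if $\mathfrak{s}(M)=M$; $K^{\mathfrak{s}\text{ -Tor}}$ is the class of $\mathfrak{s}$-torsion modules. -}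

module Defs where

open import Level using (Level; _⊔_)
open import Data.Nat using (ℕ)
open import Data.Fin using (Fin; zero; suc)
open import Data.Product using (Σ; _×_; ∃; _,_)
open import Relation.Unary using (Pred; _∈_; _⊆_; U)
open import Algebra.Bundles using (Ring)
open import Algebra.Module.Bundles using (LeftModule)
import Algebra.Module.Construct.TensorUnit as TU

-- A pp-formula in n free variables:  ∃ ȳ (m variables).  ⋀_{i<k} Σ_j A i j x_j + Σ_l B i l y_l = 0
record PPFormula {c ℓ : Level} (R : Ring c ℓ) (n : ℕ) : Set c where
  field
    nEx  : ℕ
    nEq  : ℕ
    A    : Fin nEq → Fin n → Ring.Carrier R
    B    : Fin nEq → Fin nEx → Ring.Carrier R

module _ {c ℓ m ℓm : Level} {R : Ring c ℓ} (M : LeftModule R m ℓm) where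
  open LeftModule M

  sumᴹ : {n : ℕ} → (Fin n → Carrierᴹ) → Carrierᴹ
  sumᴹ {ℕ.zero} f = 0ᴹ
  sumᴹ {ℕ.suc n} f = f zero +ᴹ sumᴹ (λ i → f (suc i))

  Sat : {p : Level} → Pred Carrierᴹ p → {n : ℕ} → PPFormula R n → (Fin n → Carrierᴹ) → Set (m ⊔ ℓm ⊔ p)
  Sat P {n} φ a = Σ (Fin nEx → Carrierᴹ) λ y → ((l : Fin nEx) → y l ∈ P) ×
      ((i : Fin nEq) → (sumᴹ (λ j → A i j *ₗ a j) +ᴹ sumᴹ (λ l → B i l *ₗ y l)) ≈ᴹ 0ᴹ)
    where open PPFormula φ

  SatM : {n : ℕ} → PPFormula R n → (Fin n → Carrierᴹ) → Set (m ⊔ ℓm)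
  SatM = Sat U

  record IsSubmodule {p : Level} (P : Pred Carrierᴹ p) : Set (c ⊔ m ⊔ ℓm ⊔ p) where
    field
      resp : ∀ {x y} → x ≈ᴹ y → x ∈ P → y ∈ P
      zero∈ : 0ᴹ ∈ P
      +∈ : ∀ {x y} → x ∈ P → y ∈ P → (x +ᴹ y) ∈ P
      *∈ : ∀ r {x} → x ∈ P → (r *ₗ x) ∈ P

  _≤p_ : {p q : Level} → Pred Carrierᴹ p → Pred Carrierᴹ q → Set (c ⊔ m ⊔ ℓm ⊔ p ⊔ q)
  P ≤p Q = (P ⊆ Q) × (∀ {n} (φ : PPFormula R n) (a : Fin n → Carrierᴹ) →
             (∀ j → a j ∈ P) → Sat Q φ a → Sat P φ a)

Low : {c ℓ : Level} (R : Ring c ℓ) → PPFormula R 1 → Set (c ⊔ ℓ)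
Low R ψ = (r : Ring.Carrier R) → SatM (TU.leftModule {R = R}) ψ (λ _ → r) → Ring._≈_ R r (Ring.0# R)

IsSTorsion : {c ℓ m ℓm p : Level} {R : Ring c ℓ} (M : LeftModule R m ℓm) → Pred (LeftModule.Carrierᴹ M) p → Set (c ⊔ ℓ ⊔ m ⊔ ℓm ⊔ p)
IsSTorsion {R = R} M P = ∀ {x} → x ∈ P → Σ (PPFormula R 1) λ ψ → Low R ψ × Sat M P ψ (λ _ → x)

-- Take L = N₁ + N₂. Any pp-formula with parameters in N₁ that holds in L holds in N, hence in
-- N₁; so N₁ ≤p L, and likewise N₂ ≤p L. An element a + b of L with a ∈ N₁, b ∈ N₂ satisfies in
-- L the formula ψ₁ ⊕ ψ₂ defining { u + v : ψ₁(u), ψ₂(v) }, where ψ₁, ψ₂ are low formulas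
-- witnessing the torsion of a and b. The sum of two low formulas is low: in R it only defines
-- sums u + v with u = 0 and v = 0.
module Submission where

open import Defs
open import Level using (Level; _⊔_; Lift; lift)
open import Data.Nat as ℕ using (ℕ)
open import Data.Fin using (Fin; zero; suc; _↑ˡ_; _↑ʳ_; splitAt)
open import Data.Fin.Properties using (join-splitAt; splitAt-↑ˡ; splitAt-↑ʳ)
open import Data.Product using (Σ; ∃₂; _×_; _,_)
open import Data.Sum using (inj₁; inj₂)
open import Data.Sum.Properties using ([,]-∘)
open import Data.Vec.Functional using (Vector; _++_; take; drop)
open import Data.Vec.Functional.Properties using (lookup-++ˡ; lookup-++ʳ; ++-cong)
open import Data.Vec.Functional.Relation.Unary.All using (All)
open import Relation.Unary using (Pred; U; _⊆_; _∈_)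
open import Relation.Binary.PropositionalEquality as ≡ using (_≗_)
open import Algebra.Bundles using (Ring; CommutativeMonoid)
open import Algebra.Module.Bundles using (LeftModule)
import Algebra.Module.Construct.TensorUnit as TU
import Algebra.Properties.AbelianGroup as AbelianGroupProperties
import Algebra.Properties.CommutativeSemigroup as CommutativeSemigroupProperties
import Relation.Binary.Reasoning.Setoid as SetoidReasoning

private
  variable
    a p q r : Level
    X : Set a
    m n : ℕ

All-++⁺ : {P : Pred X p} {xs : Vector X m} {ys : Vector X n} →
          All P xs → All P ys → All P (xs ++ ys)
All-++⁺ {m = m} Pxs Pys k with splitAt m k
... | inj₁ i = Pxs i
... | inj₂ j = Pys j

take-++-drop : ∀ m (xs : Vector X (m ℕ.+ n)) → take m xs ++ drop m xs ≗ xs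
take-++-drop {n = n} m xs k =
  ≡.trans (≡.sym ([,]-∘ xs (splitAt m k))) (≡.cong xs (join-splitAt m n k))

unit : {c ℓ : Level} (R : Ring c ℓ) → Fin n → Ring.Carrier R → Vector (Ring.Carrier R) n
unit R zero    s zero    = s
unit R zero    s (suc k) = Ring.0# R
unit R (suc j) s zero    = Ring.0# R
unit R (suc j) s (suc k) = unit R j s k

zeros : {c ℓ : Level} (R : Ring c ℓ) → ∀ n → Vector (Ring.Carrier R) n
zeros R _ _ = Ring.0# R

module _ {c ℓ : Level} {R : Ring c ℓ} where
  open Ring R using (Carrier; 0#; 1#; -_)

  -- φ ⊕ ψ is  ∃ u w v z. x = u + v ∧ φ(u; w) ∧ ψ(v; z),  the existentials laid out as
  -- (u ++ w) ++ (v ++ z) and the equations as (x - u - v) ++ (φ-rows ++ ψ-rows).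
  infixl 6 _⊕_
  _⊕_ : PPFormula R n → PPFormula R n → PPFormula R n
  _⊕_ {n} φ ψ = record
    { nEx = (n ℕ.+ φ.nEx) ℕ.+ (n ℕ.+ ψ.nEx)
    ; nEq = n ℕ.+ (φ.nEq ℕ.+ ψ.nEq)
    ; A   = (λ (j : Fin n) → unit R j 1#)
            ++ ((λ (_ : Fin φ.nEq) → zeros R n) ++ (λ _ → zeros R n))
    ; B   = (λ (j : Fin n) → (unit R j (- 1#) ++ zeros R φ.nEx) ++ (unit R j (- 1#) ++ zeros R ψ.nEx))
            ++ ((λ i → (φ.A i ++ φ.B i) ++ zeros R (n ℕ.+ ψ.nEx))
                ++ (λ i → zeros R (n ℕ.+ φ.nEx) ++ (ψ.A i ++ ψ.B i)))
    }
    where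
    module φ = PPFormula φ
    module ψ = PPFormula ψ

module _ {c ℓ cm ℓm : Level} {R : Ring c ℓ} (M : LeftModule R cm ℓm) where
  open Ring R using (Carrier; 0#; 1#; -_; _+_)
  open LeftModule M
  open AbelianGroupProperties +ᴹ-abelianGroup
    using (⁻¹-∙-comm; inverseʳ-unique; x∙y⁻¹≈ε⇒x≈y; x≈y⇒x∙y⁻¹≈ε)
  open SetoidReasoning ≈ᴹ-setoid

  private
    _-ᴹ_ : Carrierᴹ → Carrierᴹ → Carrierᴹ
    x -ᴹ y = x +ᴹ (-ᴹ y)

  -‿*ₗ : ∀ s x → (- s) *ₗ x ≈ᴹ -ᴹ (s *ₗ x)
  -‿*ₗ s x = inverseʳ-unique (s *ₗ x) ((- s) *ₗ x) (begin
    s *ₗ x +ᴹ (- s) *ₗ x ≈⟨ *ₗ-distribʳ x s (- s) ⟨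
    (s + - s) *ₗ x       ≈⟨ *ₗ-cong (Ring.-‿inverseʳ R s) ≈ᴹ-refl ⟩
    0# *ₗ x              ≈⟨ *ₗ-zeroˡ x ⟩
    0ᴹ                   ∎)

  sumᴹ-cong : {f g : Vector Carrierᴹ n} → (∀ k → f k ≈ᴹ g k) → sumᴹ M f ≈ᴹ sumᴹ M g
  sumᴹ-cong {n = ℕ.zero}  f≈g = ≈ᴹ-refl
  sumᴹ-cong {n = ℕ.suc n} f≈g = +ᴹ-cong (f≈g zero) (sumᴹ-cong (λ k → f≈g (suc k)))

  sumᴹ-++ : ∀ m (f : Vector Carrierᴹ (m ℕ.+ n)) →
            sumᴹ M f ≈ᴹ sumᴹ M (take m f) +ᴹ sumᴹ M (drop m f)
  sumᴹ-++ ℕ.zero    f = ≈ᴹ-sym (+ᴹ-identityˡ _)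
  sumᴹ-++ (ℕ.suc m) f = ≈ᴹ-trans (+ᴹ-congˡ (sumᴹ-++ m (λ k → f (suc k)))) (≈ᴹ-sym (+ᴹ-assoc _ _ _))

  lincomb : Vector Carrier n → Vector Carrierᴹ n → Carrierᴹ
  lincomb s x = sumᴹ M (λ k → s k *ₗ x k)

  lincomb-congʳ : (s : Vector Carrier n) {x y : Vector Carrierᴹ n} →
                  (∀ k → x k ≈ᴹ y k) → lincomb s x ≈ᴹ lincomb s y
  lincomb-congʳ s x≈y = sumᴹ-cong (λ k → *ₗ-cong (Ring.refl R) (x≈y k))

  lincomb-zeroˡ : (x : Vector Carrierᴹ n) → lincomb (zeros R n) x ≈ᴹ 0ᴹ
  lincomb-zeroˡ {n = ℕ.zero}  x = ≈ᴹ-refl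
  lincomb-zeroˡ {n = ℕ.suc n} x =
    ≈ᴹ-trans (+ᴹ-cong (*ₗ-zeroˡ (x zero)) (lincomb-zeroˡ (λ k → x (suc k)))) (+ᴹ-identityˡ 0ᴹ)

  lincomb-unit : ∀ (j : Fin n) s x → lincomb (unit R j s) x ≈ᴹ s *ₗ x j
  lincomb-unit {n = ℕ.suc n} zero s x =
    ≈ᴹ-trans (+ᴹ-congˡ (lincomb-zeroˡ (λ k → x (suc k)))) (+ᴹ-identityʳ _)
  lincomb-unit {n = ℕ.suc n} (suc j) s x =
    ≈ᴹ-trans (+ᴹ-cong (*ₗ-zeroˡ (x zero)) (lincomb-unit j s (λ k → x (suc k)))) (+ᴹ-identityˡ _)

  lincomb-++ : (s : Vector Carrier m) (t : Vector Carrier n) → ∀ x y →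
               lincomb (s ++ t) (x ++ y) ≈ᴹ lincomb s x +ᴹ lincomb t y
  lincomb-++ {m} s t x y = ≈ᴹ-trans (sumᴹ-++ m _) (+ᴹ-cong
    (sumᴹ-cong λ i → ≈ᴹ-reflexive (≡.cong₂ _*ₗ_ (lookup-++ˡ s t i) (lookup-++ˡ x y i)))
    (sumᴹ-cong λ j → ≈ᴹ-reflexive (≡.cong₂ _*ₗ_ (lookup-++ʳ s t j) (lookup-++ʳ x y j))))

  lincomb-++-zerosʳ : (s : Vector Carrier m) (x : Vector Carrierᴹ m) (y : Vector Carrierᴹ n) →
                      lincomb (s ++ zeros R n) (x ++ y) ≈ᴹ lincomb s x
  lincomb-++-zerosʳ s x y =
    ≈ᴹ-trans (lincomb-++ s _ x y) (≈ᴹ-trans (+ᴹ-congˡ (lincomb-zeroˡ y)) (+ᴹ-identityʳ _))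

  lincomb-zeros-++ : (t : Vector Carrier n) (x : Vector Carrierᴹ m) (y : Vector Carrierᴹ n) →
                     lincomb (zeros R m ++ t) (x ++ y) ≈ᴹ lincomb t y
  lincomb-zeros-++ t x y =
    ≈ᴹ-trans (lincomb-++ _ t x y) (≈ᴹ-trans (+ᴹ-congʳ (lincomb-zeroˡ x)) (+ᴹ-identityˡ _))

  Equation : Vector Carrierᴹ n → Vector Carrierᴹ m → Vector Carrier n → Vector Carrier m → Set ℓm
  Equation x y s t = lincomb s x +ᴹ lincomb t y ≈ᴹ 0ᴹ

  Eqs : (φ : PPFormula R n) → Vector Carrierᴹ n → Vector Carrierᴹ (PPFormula.nEx φ) → Set ℓm
  Eqs φ x y = ∀ i → Equation x y (A i) (B i)
    where open PPFormula φ

  Eqs-cong : (φ : PPFormula R n) {x x′ : Vector Carrierᴹ n} {y y′ : Vector Carrierᴹ (PPFormula.nEx φ)} →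
             (∀ k → x k ≈ᴹ x′ k) → (∀ l → y l ≈ᴹ y′ l) → Eqs φ x y → Eqs φ x′ y′
  Eqs-cong φ x≈x′ y≈y′ eqs i =
    ≈ᴹ-trans (≈ᴹ-sym (+ᴹ-cong (lincomb-congʳ (A i) x≈x′) (lincomb-congʳ (B i) y≈y′))) (eqs i)
    where open PPFormula φ

  Sat-resp : {P : Pred Carrierᴹ p} (φ : PPFormula R n) (x x′ : Vector Carrierᴹ n) →
             (∀ k → x k ≈ᴹ x′ k) → Sat M P φ x → Sat M P φ x′
  Sat-resp φ x x′ x≈x′ (y , y∈P , eqs) = y , y∈P , Eqs-cong φ {y′ = y} x≈x′ (λ _ → ≈ᴹ-refl) eqs

  Sat-mono : {P : Pred Carrierᴹ p} {Q : Pred Carrierᴹ q} → P ⊆ Q →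
             (φ : PPFormula R n) (x : Vector Carrierᴹ n) → Sat M P φ x → Sat M Q φ x
  Sat-mono P⊆Q φ x (y , y∈P , eqs) = y , (λ l → P⊆Q {y l} (y∈P l)) , eqs

  ≤p-between : {P : Pred Carrierᴹ p} {L : Pred Carrierᴹ q} {Q : Pred Carrierᴹ r} →
               _≤p_ M P Q → P ⊆ L → L ⊆ Q → _≤p_ M P L
  ≤p-between {L = L} {Q = Q} (_ , Q⇒P) P⊆L L⊆Q =
    P⊆L , λ φ x x∈P sat → Q⇒P φ x x∈P (Sat-mono {P = L} {Q = Q} L⊆Q φ x sat)

  module _ {n : ℕ} (φ ψ : PPFormula R n) (x u v : Vector Carrierᴹ n)
           (w : Vector Carrierᴹ (PPFormula.nEx φ)) (z : Vector Carrierᴹ (PPFormula.nEx ψ)) where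
    private
      module φ = PPFormula φ
      module ψ = PPFormula ψ

    ⊕-sum-row : ∀ j →
      lincomb (unit R j 1#) x
        +ᴹ lincomb ((unit R j (- 1#) ++ zeros R φ.nEx) ++ (unit R j (- 1#) ++ zeros R ψ.nEx))
                   ((u ++ w) ++ (v ++ z))
      ≈ᴹ x j -ᴹ (u j +ᴹ v j)
    ⊕-sum-row j = begin
      lincomb (unit R j 1#) x
        +ᴹ lincomb ((unit R j (- 1#) ++ _) ++ (unit R j (- 1#) ++ _)) ((u ++ w) ++ (v ++ z))
        ≈⟨ +ᴹ-congˡ (lincomb-++ _ _ (u ++ w) (v ++ z)) ⟩
      lincomb (unit R j 1#) x
        +ᴹ (lincomb (unit R j (- 1#) ++ _) (u ++ w) +ᴹ lincomb (unit R j (- 1#) ++ _) (v ++ z))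
        ≈⟨ +ᴹ-cong (lincomb-unit j 1# x)
                   (+ᴹ-cong (lincomb-++-zerosʳ _ u w) (lincomb-++-zerosʳ _ v z)) ⟩
      1# *ₗ x j +ᴹ (lincomb (unit R j (- 1#)) u +ᴹ lincomb (unit R j (- 1#)) v)
        ≈⟨ +ᴹ-cong (*ₗ-identityˡ (x j)) (+ᴹ-cong (negated u) (negated v)) ⟩
      x j +ᴹ (-ᴹ u j +ᴹ -ᴹ v j)
        ≈⟨ +ᴹ-congˡ (⁻¹-∙-comm (u j) (v j)) ⟩
      x j -ᴹ (u j +ᴹ v j) ∎
      where
      negated : ∀ y → lincomb (unit R j (- 1#)) y ≈ᴹ -ᴹ y j
      negated y = ≈ᴹ-trans (lincomb-unit j (- 1#) y)
                    (≈ᴹ-trans (-‿*ₗ 1# (y j)) (-ᴹ‿cong (*ₗ-identityˡ (y j))))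

    ⊕-left-row : ∀ i →
      lincomb (zeros R n) x
        +ᴹ lincomb ((φ.A i ++ φ.B i) ++ zeros R (n ℕ.+ ψ.nEx)) ((u ++ w) ++ (v ++ z))
      ≈ᴹ lincomb (φ.A i) u +ᴹ lincomb (φ.B i) w
    ⊕-left-row i = ≈ᴹ-trans (+ᴹ-cong (lincomb-zeroˡ x) (lincomb-++-zerosʳ _ (u ++ w) (v ++ z)))
                            (≈ᴹ-trans (+ᴹ-identityˡ _) (lincomb-++ (φ.A i) (φ.B i) u w))

    ⊕-right-row : ∀ i →
      lincomb (zeros R n) x
        +ᴹ lincomb (zeros R (n ℕ.+ φ.nEx) ++ (ψ.A i ++ ψ.B i)) ((u ++ w) ++ (v ++ z))
      ≈ᴹ lincomb (ψ.A i) v +ᴹ lincomb (ψ.B i) z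
    ⊕-right-row i = ≈ᴹ-trans (+ᴹ-cong (lincomb-zeroˡ x) (lincomb-zeros-++ _ (u ++ w) (v ++ z)))
                             (≈ᴹ-trans (+ᴹ-identityˡ _) (lincomb-++ (ψ.A i) (ψ.B i) v z))

    Eqs-⊕⁺ : Eqs φ u w → Eqs ψ v z → (∀ j → u j +ᴹ v j ≈ᴹ x j) →
             Eqs (φ ⊕ ψ) x ((u ++ w) ++ (v ++ z))
    Eqs-⊕⁺ eqsφ eqsψ u+v≈x k with splitAt n k
    ... | inj₁ j = ≈ᴹ-trans (⊕-sum-row j) (x≈y⇒x∙y⁻¹≈ε (≈ᴹ-sym (u+v≈x j)))
    ... | inj₂ k′ with splitAt φ.nEq k′
    ...   | inj₁ i = ≈ᴹ-trans (⊕-left-row i) (eqsφ i)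
    ...   | inj₂ i = ≈ᴹ-trans (⊕-right-row i) (eqsψ i)

    Eqs-⊕⁻ : Eqs (φ ⊕ ψ) x ((u ++ w) ++ (v ++ z)) →
             Eqs φ u w × Eqs ψ v z × (∀ j → u j +ᴹ v j ≈ᴹ x j)
    Eqs-⊕⁻ eqs = left , right , sums
      where
      left : Eqs φ u w
      left i with eqs (n ↑ʳ (i ↑ˡ ψ.nEq))
      ... | e rewrite splitAt-↑ʳ n (φ.nEq ℕ.+ ψ.nEq) (i ↑ˡ ψ.nEq) | splitAt-↑ˡ φ.nEq i ψ.nEq =
        ≈ᴹ-trans (≈ᴹ-sym (⊕-left-row i)) e
      right : Eqs ψ v z
      right i with eqs (n ↑ʳ (φ.nEq ↑ʳ i))
      ... | e rewrite splitAt-↑ʳ n (φ.nEq ℕ.+ ψ.nEq) (φ.nEq ↑ʳ i) | splitAt-↑ʳ φ.nEq ψ.nEq i =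
        ≈ᴹ-trans (≈ᴹ-sym (⊕-right-row i)) e
      sums : ∀ j → u j +ᴹ v j ≈ᴹ x j
      sums j with eqs (j ↑ˡ (φ.nEq ℕ.+ ψ.nEq))
      ... | e rewrite splitAt-↑ˡ n j (φ.nEq ℕ.+ ψ.nEq) =
        ≈ᴹ-sym (x∙y⁻¹≈ε⇒x≈y _ _ (≈ᴹ-trans (≈ᴹ-sym (⊕-sum-row j)) e))

  Sat-⊕⁺ : {P : Pred Carrierᴹ p} (φ ψ : PPFormula R n) (x u v : Vector Carrierᴹ n) →
           All P u → All P v → Sat M P φ u → Sat M P ψ v → (∀ j → u j +ᴹ v j ≈ᴹ x j) →
           Sat M P (φ ⊕ ψ) x
  Sat-⊕⁺ {P = P} φ ψ x u v u∈P v∈P (w , w∈P , eqsφ) (z , z∈P , eqsψ) u+v≈x =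
    (u ++ w) ++ (v ++ z) ,
    All-++⁺ {P = P} (All-++⁺ {P = P} u∈P w∈P) (All-++⁺ {P = P} v∈P z∈P) ,
    Eqs-⊕⁺ φ ψ x u v w z eqsφ eqsψ u+v≈x

  Sat-⊕⁻ : {P : Pred Carrierᴹ p} (φ ψ : PPFormula R n) (x : Vector Carrierᴹ n) →
           Sat M P (φ ⊕ ψ) x →
           ∃₂ λ u v → Sat M P φ u × Sat M P ψ v × (∀ j → u j +ᴹ v j ≈ᴹ x j)
  Sat-⊕⁻ {n = n} φ ψ x (y , y∈P , eqs) =
    let eqsφ , eqsψ , u+v≈x = Eqs-⊕⁻ φ ψ x u v w z (Eqs-cong (φ ⊕ ψ) (λ _ → ≈ᴹ-refl) split eqs) in
    u , v ,
    (w , (λ l → y∈P ((n ↑ʳ l) ↑ˡ _)) , eqsφ) ,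
    (z , (λ l → y∈P ((n ℕ.+ PPFormula.nEx φ) ↑ʳ (n ↑ʳ l))) , eqsψ) ,
    u+v≈x
    where
    yφ = take (n ℕ.+ PPFormula.nEx φ) y
    yψ = drop (n ℕ.+ PPFormula.nEx φ) y
    u = take n yφ
    w = drop n yφ
    v = take n yψ
    z = drop n yψ
    split : ∀ l → y l ≈ᴹ ((u ++ w) ++ (v ++ z)) l
    split l = ≈ᴹ-reflexive (≡.sym (≡.trans
      (++-cong (u ++ w) yφ (take-++-drop n yφ) (take-++-drop n yψ) l)
      (take-++-drop (n ℕ.+ PPFormula.nEx φ) y l)))

Low-⊕ : {c ℓ : Level} {R : Ring c ℓ} (φ ψ : PPFormula R 1) → Low R φ → Low R ψ → Low R (φ ⊕ ψ)
Low-⊕ {R = R} φ ψ lowφ lowψ s sat with Sat-⊕⁻ TU.leftModule φ ψ (λ _ → s) sat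
... | u , v , satφ , satψ , u+v≈s = begin
  s                 ≈⟨ u+v≈s zero ⟨
  u zero + v zero   ≈⟨ +-cong (lowφ (u zero) (Sat-resp TU.leftModule φ u _ (constant u) satφ))
                              (lowψ (v zero) (Sat-resp TU.leftModule ψ v _ (constant v) satψ)) ⟩
  0# + 0#           ≈⟨ +-identityˡ 0# ⟩
  0#                ∎
  where
  open Ring R using (Carrier; _≈_; _+_; 0#; +-cong; +-identityˡ; refl; setoid)
  open SetoidReasoning setoid
  constant : (x : Vector Carrier 1) → ∀ k → x k ≈ x zero
  constant x zero = refl

module SubmoduleSum {c ℓ cm ℓm : Level} {R : Ring c ℓ} (M : LeftModule R cm ℓm) (r : Level) where
  open LeftModule M
  open CommutativeSemigroupProperties (CommutativeMonoid.commutativeSemigroup +ᴹ-commutativeMonoid)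
    using (interchange)

  -- r only raises the universe level, so that the sum can sit at the level the theorem asks for.
  _+ₛ_ : Pred Carrierᴹ p → Pred Carrierᴹ q → Pred Carrierᴹ (cm ⊔ ℓm ⊔ p ⊔ q ⊔ r)
  (P +ₛ Q) x = Lift r (∃₂ λ a b → a ∈ P × b ∈ Q × a +ᴹ b ≈ᴹ x)

  module _ {P : Pred Carrierᴹ p} {Q : Pred Carrierᴹ q}
           (P-sub : IsSubmodule M P) (Q-sub : IsSubmodule M Q) where
    private
      module P = IsSubmodule P-sub
      module Q = IsSubmodule Q-sub

    +ₛ-isSubmodule : IsSubmodule M (P +ₛ Q)
    +ₛ-isSubmodule = record
      { resp  = λ { x≈y (lift (a , b , a∈P , b∈Q , a+b≈x)) →
                    lift (a , b , a∈P , b∈Q , ≈ᴹ-trans a+b≈x x≈y) }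
      ; zero∈ = lift (0ᴹ , 0ᴹ , P.zero∈ , Q.zero∈ , +ᴹ-identityˡ 0ᴹ)
      ; +∈    = λ { (lift (a , b , a∈P , b∈Q , a+b≈x)) (lift (a′ , b′ , a′∈P , b′∈Q , a′+b′≈y)) →
                    lift (a +ᴹ a′ , b +ᴹ b′ , P.+∈ a∈P a′∈P , Q.+∈ b∈Q b′∈Q ,
                          ≈ᴹ-trans (interchange a a′ b b′) (+ᴹ-cong a+b≈x a′+b′≈y)) }
      ; *∈    = λ { s (lift (a , b , a∈P , b∈Q , a+b≈x)) →
                    lift (s *ₗ a , s *ₗ b , P.*∈ s a∈P , Q.*∈ s b∈Q ,
                          ≈ᴹ-trans (≈ᴹ-sym (*ₗ-distribˡ s a b)) (*ₗ-congˡ a+b≈x)) }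
      }

    ⊆-+ₛˡ : P ⊆ P +ₛ Q
    ⊆-+ₛˡ {x = a} a∈P = lift (a , 0ᴹ , a∈P , Q.zero∈ , +ᴹ-identityʳ a)

    ⊆-+ₛʳ : Q ⊆ P +ₛ Q
    ⊆-+ₛʳ {x = b} b∈Q = lift (0ᴹ , b , P.zero∈ , b∈Q , +ᴹ-identityˡ b)

    +ₛ-isSTorsion : IsSTorsion M P → IsSTorsion M Q → IsSTorsion M (P +ₛ Q)
    +ₛ-isSTorsion P-tors Q-tors (lift (a , b , a∈P , b∈Q , a+b≈x))
      with P-tors a∈P | Q-tors b∈Q
    ... | φ , lowφ , satφ | ψ , lowψ , satψ =
      φ ⊕ ψ , Low-⊕ φ ψ lowφ lowψ ,
      Sat-⊕⁺ M φ ψ _ (λ _ → a) (λ _ → b) (λ _ → ⊆-+ₛˡ a∈P) (λ _ → ⊆-+ₛʳ b∈Q)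
        (Sat-mono M {P = P} ⊆-+ₛˡ φ (λ _ → a) satφ) (Sat-mono M {P = Q} ⊆-+ₛʳ ψ (λ _ → b) satψ)
        (λ _ → a+b≈x)

lemma4p2 : {c ℓ m ℓm p : Level} (R : Ring c ℓ) (N : LeftModule R m ℓm)
    (N₁ N₂ : Pred (LeftModule.Carrierᴹ N) p) →
    IsSubmodule N N₁ → IsSubmodule N N₂ →
    IsSTorsion N N₁ → IsSTorsion N N₂ →
    _≤p_ N N₁ U → _≤p_ N N₂ U →
    Σ (Pred (LeftModule.Carrierᴹ N) (c ⊔ ℓ ⊔ m ⊔ ℓm ⊔ p)) λ L →
      IsSubmodule N L × IsSTorsion N L × _≤p_ N N₁ L × _≤p_ N N₂ L
lemma4p2 {c} {ℓ} R N N₁ N₂ N₁-sub N₂-sub N₁-tors N₂-tors N₁≤N N₂≤N =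
  N₁ +ₛ N₂ ,
  +ₛ-isSubmodule N₁-sub N₂-sub ,
  +ₛ-isSTorsion N₁-sub N₂-sub N₁-tors N₂-tors ,
  ≤p-between N N₁≤N (⊆-+ₛˡ N₁-sub N₂-sub) _ ,
  ≤p-between N N₂≤N (⊆-+ₛʳ N₁-sub N₂-sub) _
  where open SubmoduleSum N (c ⊔ ℓ)
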